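{- Let $k \ge k_0 > \ell \ge 1$ and $\lambda \ge 2$ be integers, let $\lambda_i = (k\lambda)^{2^{i-1}}$ for $i \ge 1$, and let $\mathcal{H}$ be an $S_{\lambda}(\ell)$-free $k$-graph on vertex set $V$. Run the following decomposition algorithm: start with $\mathcal{F} = \{\mathcal{H}\}$. While some member $\mathcal{G} \in \mathcal{F}$, say a $k'$-graph, is $k_0$-decomposable (i.e., $k' > k_0$ and $\mathcal{G}$ contains a copy of $S_{\lambda_i}(k'-i)$ for some $i \in \{1,\dots,k'-k_0\}$), let $i_0$ be the smallest such $i$, set $$\mathcal{G}_{k'-i_0} = \left\{A \in \binom{V}{k'-i_0} : d_{\mathcal{G}}(A) \ge \lambda_{i_0}\right\},\qquad \mathcal{G}_{k'} = \left\{B \in \mathcal{G} : \binom{B}{k'-i_0} \cap \mathcal{G}_{k'-i_0} = \emptyset\right\},$$ and replace $\mathcal{G}$ in $\mathcal{F}$ by $\mathcal{G}_{k'-i_0}$ and $\mathcal{G}_{k'}$. Let $\mathcal{F}$ be the family output when no member is $k_0$-decomposable. Then $$\alpha(\mathcal{H}) \ge \alpha\left(\bigcup_{\mathcal{G} \in \mathcal{F}} \mathcal{G}\right).$$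
   Context: A $k$-graph is a family of $k$-element subsets (edges) of a finite vertex set. $S_{\lambda}(j)$ (of the appropriate uniformity) is the hypergraph of $\lambda$ edges $E_1,\dots,E_\lambda$ with $E_i \cap E_j = S$ for all pairs, for a fixed $j$-set $S$. $d_{\mathcal{G}}(A)$ is the number of edges of $\mathcal{G}$ containing $A$. $\bigcup_{\mathcal{G}\in\mathcal{F}}\mathcal{G}$ is the (non-uniform) hypergraph on $V$ whose edge set is the union of the edge sets; a set is independent if it contains no edge, and $\alpha$ denotes the maximum size of an independent set. -}

module Defs where

open import Data.Nat using (ℕ; zero; suc; _+_; _*_; _∸_; _^_; _≤_; _<_; _≤ᵇ_; _≡ᵇ_; _⊔_)
open import Data.Bool using (Bool; true; false; _∧_; not; if_then_else_)
open import Data.Fin using (Fin)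
open import Data.Fin.Subset using (Subset; _⊆_; _∩_; ∣_∣; inside; outside)
open import Data.Fin.Subset.Properties using (_⊆?_)
open import Data.List using (List; []; _∷_; _++_; map; length; filterᵇ; foldr)
open import Data.Bool.ListAction using (all; any)
open import Data.List.Relation.Unary.All using (All)
open import Data.Product using (Σ; ∃; _×_; _,_; proj₁; proj₂)
open import Data.Vec using (_∷_; [])
open import Relation.Nullary using (¬_; does)
open import Relation.Binary.PropositionalEquality using (_≡_; _≢_)
open import Relation.Binary.Construct.Closure.ReflexiveTransitive using (Star)

-- A (not necessarily uniform) hypergraph on the vertex set V = Fin n,
-- given by the characteristic function of its edge set.
Hypergraph : ℕ → Set
Hypergraph n = Subset n → Bool

_∈E_ : ∀ {n} → Subset n → Hypergraph n → Set
B ∈E G = G B ≡ true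

IsKGraph : ∀ {n} → ℕ → Hypergraph n → Set
IsKGraph k G = ∀ B → B ∈E G → ∣ B ∣ ≡ k

allSubsets : (n : ℕ) → List (Subset n)
allSubsets zero = [] ∷ []
allSubsets (suc n) = map (outside ∷_) (allSubsets n) ++ map (inside ∷_) (allSubsets n)

_⊆ᵇ_ : ∀ {n} → Subset n → Subset n → Bool
A ⊆ᵇ B = does (A ⊆? B)

deg : ∀ {n} → Hypergraph n → Subset n → ℕ
deg {n} G A = length (filterᵇ (λ B → G B ∧ (A ⊆ᵇ B)) (allSubsets n))

ContainsS : ∀ {n} → Hypergraph n → (lam j : ℕ) → Set
ContainsS {n} G lam j =
  Σ (Subset n) λ S → ∣ S ∣ ≡ j ×
  Σ (Fin lam → Subset n) λ E →
    (∀ a → E a ∈E G) × (∀ a b → a ≢ b → E a ∩ E b ≡ S)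

lamSeq : (k lam i : ℕ) → ℕ
lamSeq k lam i = (k * lam) ^ (2 ^ (i ∸ 1))

Decomposable : ∀ {n} → (k lam k0 : ℕ) → ℕ × Hypergraph n → Set
Decomposable k lam k0 (k' , G) =
  k0 < k' × Σ ℕ λ i → 1 ≤ i × i ≤ k' ∸ k0 × ContainsS G (lamSeq k lam i) (k' ∸ i)

lowPart : ∀ {n} → (k lam k' i0 : ℕ) → Hypergraph n → Hypergraph n
lowPart k lam k' i0 G A = (∣ A ∣ ≡ᵇ (k' ∸ i0)) ∧ (lamSeq k lam i0 ≤ᵇ deg G A)

highPart : ∀ {n} → (k lam k' i0 : ℕ) → Hypergraph n → Hypergraph n
highPart {n} k lam k' i0 G B =
  G B ∧ all (λ A → not ((A ⊆ᵇ B) ∧ lowPart k lam k' i0 G A)) (allSubsets n)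

-- A family is a list of (uniformity k', k'-graph G).
Family : ℕ → Set
Family n = List (ℕ × Hypergraph n)

-- One step of the decomposition algorithm (any decomposable member may be chosen).
data Step {n : ℕ} (k lam k0 : ℕ) : Family n → Family n → Set where
  step : (xs ys : Family n) (k' : ℕ) (G : Hypergraph n) (i0 : ℕ) →
         k0 < k' → 1 ≤ i0 → i0 ≤ k' ∸ k0 →
         ContainsS G (lamSeq k lam i0) (k' ∸ i0) →
         (∀ i → 1 ≤ i → i < i0 → ¬ ContainsS G (lamSeq k lam i) (k' ∸ i)) →
         Step k lam k0 (xs ++ (k' , G) ∷ ys)
                       (xs ++ (k' ∸ i0 , lowPart k lam k' i0 G)
                              ∷ (k' , highPart k lam k' i0 G) ∷ ys)

IsOutput : ∀ {n} → (k lam k0 : ℕ) → Hypergraph n → Family n → Set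
IsOutput k lam k0 H F =
  Star (Step k lam k0) ((k , H) ∷ []) F × All (λ p → ¬ Decomposable k lam k0 p) F

⋃ : ∀ {n} → Family n → Hypergraph n
⋃ F B = any (λ p → proj₂ p B) F

Independent : ∀ {n} → Hypergraph n → Subset n → Set
Independent G I = ∀ B → B ∈E G → ¬ (B ⊆ I)

independentᵇ : ∀ {n} → Hypergraph n → Subset n → Bool
independentᵇ {n} G I = all (λ B → not (G B ∧ (B ⊆ᵇ I))) (allSubsets n)

α : ∀ {n} → Hypergraph n → ℕ
α {n} G = foldr _⊔_ 0
  (map (λ I → if independentᵇ G I then ∣ I ∣ else 0) (allSubsets n))

-- Each step of the decomposition replaces a member G by G_{k'-i0} and G_{k'}, and every edge
-- B of G either survives in G_{k'} or contains a (k'-i0)-set of G_{k'-i0}. So throughout the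
-- algorithm every edge of H contains an edge of the current union, whence every independent
-- set of the final union is independent in H.
module Submission where

open import Defs
open import Data.Bool using (true; false; T; not; _∧_; if_then_else_)
open import Data.Bool.Properties using (T-≡; T-∧; T?)
open import Data.Empty using (⊥-elim)
open import Data.Fin.Subset using (Subset; _⊆_; inside; outside)
open import Data.Fin.Subset.Properties using (_⊆?_; ⊆-refl; ⊆-trans)
open import Data.List using ([]; _∷_; _++_; map; foldr)
open import Data.List.Membership.Propositional using (_∈_)
open import Data.List.Membership.Propositional.Properties using (∈-map⁺; ∈-++⁺ˡ; ∈-++⁺ʳ)
import Data.List.Relation.Unary.All as All
open import Data.List.Relation.Unary.All.Properties using (all⁺; all⁻; ¬Any⇒All¬)
open import Data.List.Relation.Unary.Any as Any using (Any; here; there; any?)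
open import Data.List.Relation.Unary.Any.Properties using (any⁺; any⁻; ++⁺ˡ; ++⁺ʳ; ++⁻)
open import Data.Nat using (ℕ; zero; suc; _≤_; _<_; _⊔_; z≤n)
open import Data.Nat.Properties using (⊔-mono-≤; ≤-refl)
open import Data.Product using (∃; _×_; _,_; proj₂)
open import Data.Sum using (_⊎_; inj₁; inj₂)
open import Data.Unit using (tt)
open import Data.Vec using ([]; _∷_)
open import Function using (_∘_)
open import Function.Bundles using (Equivalence)
open import Relation.Binary.Construct.Closure.ReflexiveTransitive using (Star; fold)
open import Relation.Binary.PropositionalEquality using (refl)
open import Relation.Nullary using (¬_; yes; no)

open Equivalence using (to; from)

T-not⁺ : ∀ {b} → ¬ T b → T (not b)
T-not⁺ {false} _  = tt
T-not⁺ {true}  ¬b = ¬b tt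

T-not⁻ : ∀ {b} → T (not b) → ¬ T b
T-not⁻ {false} _ ()

⊆ᵇ⇒⊆ : ∀ {n} {A B : Subset n} → T (A ⊆ᵇ B) → A ⊆ B
⊆ᵇ⇒⊆ {A = A} {B} A⊆ᵇB with A ⊆? B
... | yes A⊆B = A⊆B

⊆⇒⊆ᵇ : ∀ {n} {A B : Subset n} → A ⊆ B → T (A ⊆ᵇ B)
⊆⇒⊆ᵇ {A = A} {B} A⊆B with A ⊆? B
... | yes _   = tt
... | no A⊈B = A⊈B A⊆B

∈-allSubsets : ∀ {n} (A : Subset n) → A ∈ allSubsets n
∈-allSubsets {zero}  []            = here refl
∈-allSubsets {suc n} (outside ∷ A) = ∈-++⁺ˡ (∈-map⁺ (outside ∷_) (∈-allSubsets A))
∈-allSubsets {suc n} (inside ∷ A)  =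
  ∈-++⁺ʳ (map (outside ∷_) (allSubsets n)) (∈-map⁺ (inside ∷_) (∈-allSubsets A))

independentᵇ⇒Independent : ∀ {n} {G : Hypergraph n} {I} → T (independentᵇ G I) → Independent G I
independentᵇ⇒Independent {n} indᵇ B B∈G B⊆I =
  T-not⁻ (All.lookup (all⁺ _ (allSubsets n) indᵇ) (∈-allSubsets B))
         (from T-∧ (from T-≡ B∈G , ⊆⇒⊆ᵇ B⊆I))

Independent⇒independentᵇ : ∀ {n} {G : Hypergraph n} {I} → Independent G I → T (independentᵇ G I)
Independent⇒independentᵇ {n} ind =
  all⁻ _ {allSubsets n} (All.tabulate λ {B} _ → T-not⁺ λ B∈G∧B⊆I →
    let B∈G , B⊆I = to T-∧ B∈G∧B⊆I in ind B (to T-≡ B∈G) (⊆ᵇ⇒⊆ B⊆I))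

Covers : ∀ {n} → Hypergraph n → Hypergraph n → Set
Covers G G′ = ∀ B → B ∈E G → ∃ λ B′ → B′ ⊆ B × B′ ∈E G′

Covers-refl : ∀ {n} {G : Hypergraph n} → Covers G G
Covers-refl B B∈G = B , ⊆-refl , B∈G

Covers-trans : ∀ {n} {G₁ G₂ G₃ : Hypergraph n} → Covers G₁ G₂ → Covers G₂ G₃ → Covers G₁ G₃
Covers-trans c₁₂ c₂₃ B B∈G₁ =
  let B′ , B′⊆B , B′∈G₂ = c₁₂ B B∈G₁
      B″ , B″⊆B′ , B″∈G₃ = c₂₃ B′ B′∈G₂
  in B″ , ⊆-trans B″⊆B′ B′⊆B , B″∈G₃

Independent-antitone : ∀ {n} {G G′ : Hypergraph n} {I} →
  Covers G G′ → Independent G′ I → Independent G I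
Independent-antitone c ind B B∈G B⊆I =
  let B′ , B′⊆B , B′∈G′ = c B B∈G in ind B′ B′∈G′ (⊆-trans B′⊆B B⊆I)

if-then-0-mono : ∀ {b b′} x → (T b → T b′) → (if b then x else 0) ≤ (if b′ then x else 0)
if-then-0-mono {false}         x _    = z≤n
if-then-0-mono {true} {true}   x _    = ≤-refl
if-then-0-mono {true} {false}  x b⇒b′ = ⊥-elim (b⇒b′ tt)

foldr-⊔-map-mono : ∀ {A : Set} {f g : A → ℕ} → (∀ x → f x ≤ g x) → ∀ xs →
  foldr _⊔_ 0 (map f xs) ≤ foldr _⊔_ 0 (map g xs)
foldr-⊔-map-mono f≤g []       = z≤n
foldr-⊔-map-mono f≤g (x ∷ xs) = ⊔-mono-≤ (f≤g x) (foldr-⊔-map-mono f≤g xs)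

α-antitone : ∀ {n} {G G′ : Hypergraph n} → Covers G G′ → α G′ ≤ α G
α-antitone {n} c = foldr-⊔-map-mono (λ I → if-then-0-mono _ (
  Independent⇒independentᵇ ∘ Independent-antitone c ∘ independentᵇ⇒Independent))
  (allSubsets n)

∈E-⋃⁻ : ∀ {n} {B : Subset n} F → B ∈E ⋃ F → Any (λ p → B ∈E proj₂ p) F
∈E-⋃⁻ F B∈⋃F = Any.map (to T-≡) (any⁻ _ F (from T-≡ B∈⋃F))

∈E-⋃⁺ : ∀ {n} {B : Subset n} {F} → Any (λ p → B ∈E proj₂ p) F → B ∈E ⋃ F
∈E-⋃⁺ B∈some = to T-≡ (any⁺ _ (Any.map (from T-≡) B∈some))

edge-highPart-or-⊇-lowPart : ∀ {n} k lam k′ i0 (G : Hypergraph n) {B} → B ∈E G →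
  B ∈E highPart k lam k′ i0 G ⊎ ∃ λ A → A ⊆ B × A ∈E lowPart k lam k′ i0 G
edge-highPart-or-⊇-lowPart {n} k lam k′ i0 G {B} B∈G
  with any? (λ A → T? ((A ⊆ᵇ B) ∧ lowPart k lam k′ i0 G A)) (allSubsets n)
... | yes low⊆B = let A , A⊆B∧A∈low = Any.satisfied low⊆B
                      A⊆B , A∈low = to T-∧ A⊆B∧A∈low
                  in inj₂ (A , ⊆ᵇ⇒⊆ A⊆B , to T-≡ A∈low)
... | no ¬low⊆B = inj₁ (to T-≡ (from T-∧
                    (from T-≡ B∈G , all⁻ _ (All.map T-not⁺ (¬Any⇒All¬ _ ¬low⊆B)))))

Step-covers : ∀ {n k lam k0} {F F′ : Family n} → Step k lam k0 F F′ → Covers (⋃ F) (⋃ F′)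
Step-covers {k = k} {lam} (step xs ys k′ G i0 _ _ _ _ _) B B∈⋃F
  with ++⁻ xs (∈E-⋃⁻ (xs ++ _) B∈⋃F)
... | inj₁ B∈xs           = B , ⊆-refl , ∈E-⋃⁺ (++⁺ˡ B∈xs)
... | inj₂ (there B∈ys)   = B , ⊆-refl , ∈E-⋃⁺ (++⁺ʳ xs (there (there B∈ys)))
... | inj₂ (here B∈G) with edge-highPart-or-⊇-lowPart k lam k′ i0 G B∈G
...   | inj₁ B∈high            = B , ⊆-refl , ∈E-⋃⁺ (++⁺ʳ xs (there (here B∈high)))
...   | inj₂ (A , A⊆B , A∈low) = A , A⊆B , ∈E-⋃⁺ (++⁺ʳ xs (here A∈low))

Star-covers : ∀ {n k lam k0} {F F′ : Family n} → Star (Step k lam k0) F F′ → Covers (⋃ F) (⋃ F′)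
Star-covers = fold (λ F F′ → Covers (⋃ F) (⋃ F′)) (Covers-trans ∘ Step-covers) Covers-refl

lemma3p3 : (n k k0 l lam : ℕ) → k0 ≤ k → l < k0 → 1 ≤ l → 2 ≤ lam →
    (H : Hypergraph n) → IsKGraph k H → ¬ ContainsS H lam l →
    (F : Family n) → IsOutput k lam k0 H F →
    α (⋃ F) ≤ α H
lemma3p3 n k k0 l lam _ _ _ _ H _ _ F (run , _) =
  α-antitone (Covers-trans H-covers-start (Star-covers run))
  where
  H-covers-start : Covers H (⋃ ((k , H) ∷ []))
  H-covers-start B B∈H = B , ⊆-refl , ∈E-⋃⁺ {F = (k , H) ∷ []} (here B∈H)
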